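{- The class $R(\cap,;)$ of $(\cdot,\circ)$-structures isomorphic to a set of binary relations on some base set closed under intersection and composition (with $\cdot$ interpreted as $\cap$ and $\circ$ as composition $;$) is finitely axiomatisable by first-order axioms.
   Context: Composition of binary relations: $R;S=\{(x,y):\exists z\,((x,z)\in R\wedge(z,y)\in S)\}$. A $(\cdot,\circ)$-structure is a set with two binary operations $\cdot$ and $\circ$. -}

module Defs where

open import Level using (0ℓ)
open import Data.Nat using (ℕ; zero; suc)
open import Data.Fin using (Fin; zero; suc)
open import Data.Product using (Σ; ∃; _×_; _,_)
open import Data.Sum using (_⊎_)
open import Data.Empty using (⊥)
open import Data.List using (List)
open import Data.List.Relation.Unary.All using (All)
open import Relation.Nullary using (¬_)
open import Relation.Binary.PropositionalEquality using (_≡_)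
open import Function.Bundles using (_⇔_)

record Structure : Set₁ where
  field
    Carrier : Set
    _·_     : Carrier → Carrier → Carrier
    _∘_     : Carrier → Carrier → Carrier

BinRel : Set → Set₁
BinRel X = X → X → Set

_∩_ : {X : Set} → BinRel X → BinRel X → BinRel X
(R ∩ S) x y = R x y × S x y

_⨾_ : {X : Set} → BinRel X → BinRel X → BinRel X
(R ⨾ S) x y = ∃ λ z → R x z × S z y

_≐_ : {X : Set} → BinRel X → BinRel X → Set
R ≐ S = ∀ x y → R x y ⇔ S x y

-- A is isomorphic to a set of binary relations on some base set X closed
-- under ∩ and ; (namely the image of h), with · as ∩ and ∘ as ;
record Representation (A : Structure) : Set₁ where
  open Structure A
  field
    Base  : Set
    h     : Carrier → BinRel Base
    h-·   : ∀ a b → h (a · b) ≐ (h a ∩ h b)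
    h-∘   : ∀ a b → h (a ∘ b) ≐ (h a ⨾ h b)
    h-inj : ∀ a b → h a ≐ h b → a ≡ b

Representable : Structure → Set₁
Representable A = Representation A

-- First-order logic over the signature {·, ∘} with equality
-- (de Bruijn variables; n = number of free variables)
data Term (n : ℕ) : Set where
  var  : Fin n → Term n
  _·ₜ_ : Term n → Term n → Term n
  _∘ₜ_ : Term n → Term n → Term n

data Formula (n : ℕ) : Set where
  _≈_  : Term n → Term n → Formula n
  ⊥f   : Formula n
  ¬f_  : Formula n → Formula n
  _∧f_ : Formula n → Formula n → Formula n
  _∨f_ : Formula n → Formula n → Formula n
  _⇒f_ : Formula n → Formula n → Formula n
  ∀f   : Formula (suc n) → Formula n
  ∃f   : Formula (suc n) → Formula n

Sentence : Set
Sentence = Formula 0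

module _ (A : Structure) where
  open Structure A

  extend : {n : ℕ} → (Fin n → Carrier) → Carrier → Fin (suc n) → Carrier
  extend ρ a zero    = a
  extend ρ a (suc i) = ρ i

  ⟦_⟧t : {n : ℕ} → Term n → (Fin n → Carrier) → Carrier
  ⟦ var i ⟧t ρ  = ρ i
  ⟦ s ·ₜ t ⟧t ρ = ⟦ s ⟧t ρ · ⟦ t ⟧t ρ
  ⟦ s ∘ₜ t ⟧t ρ = ⟦ s ⟧t ρ ∘ ⟦ t ⟧t ρ

  Sat : {n : ℕ} → Formula n → (Fin n → Carrier) → Set
  Sat (s ≈ t)   ρ = ⟦ s ⟧t ρ ≡ ⟦ t ⟧t ρ
  Sat ⊥f        ρ = ⊥
  Sat (¬f φ)    ρ = ¬ Sat φ ρ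
  Sat (φ ∧f ψ)  ρ = Sat φ ρ × Sat ψ ρ
  Sat (φ ∨f ψ)  ρ = Sat φ ρ ⊎ Sat ψ ρ
  Sat (φ ⇒f ψ)  ρ = Sat φ ρ → Sat ψ ρ
  Sat (∀f φ)    ρ = ∀ a → Sat φ (extend ρ a)
  Sat (∃f φ)    ρ = ∃ λ a → Sat φ (extend ρ a)

emptyEnv : {B : Set} → Fin 0 → B
emptyEnv ()

_⊨_ : Structure → Sentence → Set
A ⊨ φ = Sat A φ emptyEnv

_⊨all_ : Structure → List Sentence → Set
A ⊨all Ax = All (A ⊨_) Ax

-- Law of excluded middle (the paper's metatheory is classical)
ExcludedMiddle : Set₁
ExcludedMiddle = (P : Set) → P ⊎ ¬ P

-- The axioms say that · is a semilattice, ∘ is associative, and ∘ is monotone in each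
-- argument for the semilattice order; all of this holds for relations. Conversely, fix
-- a₀ and grow a network from a single edge O → I labelled a₀: whenever a pair x, y is
-- labelled by a composite a ∘ b, a new point is inserted with edges x → · labelled a and
-- · → y labelled b. The label of a pair is the up-closed set of composites along its
-- paths, computed by unfolding the younger endpoint. Placing every new point at the
-- midpoint of its neighbours makes the network acyclic, which gives closure of labels
-- under ·; closure under ∘ holds by construction. The disjoint union of these networks
-- over all a₀ represents A, faithfully because a₀ is the label of O → I.
module Submission where

open import Defs
open import Level using (0ℓ)
open import Data.Nat using (ℕ; _⊔_; z≤n)
import Data.Nat as ℕ
import Data.Nat.Properties as ℕ
open import Data.Fin using (zero; suc)
open import Data.Rational using (ℚ; 0ℚ; 1ℚ; ½; _+_; _*_; _<_)
import Data.Rational.Properties as ℚ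
open import Data.Product using (Σ; ∃; _×_; _,_; proj₁; proj₂)
open import Data.Sum using (_⊎_; inj₁; inj₂)
open import Data.Unit using (⊤; tt)
open import Data.List using (List; []; _∷_)
open import Data.List.Relation.Unary.All using ([]; _∷_)
open import Function.Bundles using (_⇔_; mk⇔; Equivalence)
open import Function.Properties.Equivalence using () renaming (sym to ⇔-sym; trans to ⇔-trans)
open import Relation.Nullary using (¬_; yes; no; contradiction)
open import Relation.Binary.Core using (_⇒_)
open import Relation.Binary.PropositionalEquality
  using (_≡_; refl; sym; subst; module ≡-Reasoning)
open import Relation.Binary.PropositionalEquality.Algebra using (isMagma)
open import Algebra.Lattice.Bundles using (Semilattice)
open import Relation.Binary.Lattice using (module IsMeetSemilattice)
import Algebra.Lattice.Properties.Semilattice as SemilatticeProperties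
import Relation.Binary.Construct.NaturalOrder.Left as NaturalOrder

midpoint : ℚ → ℚ → ℚ
midpoint p q = (p + q) * ½

midpoint-idem : ∀ p → midpoint p p ≡ p
midpoint-idem p = begin
  (p + p) * ½         ≡⟨ ℚ.*-distribʳ-+ ½ p p ⟩
  p * ½ + p * ½       ≡⟨ sym (ℚ.*-distribˡ-+ p ½ ½) ⟩
  p * (½ + ½)         ≡⟨ ℚ.*-identityʳ p ⟩
  p                   ∎
  where open ≡-Reasoning

<⇒<midpoint : ∀ {p q} → p < q → p < midpoint p q
<⇒<midpoint {p} {q} p<q =
  subst (_< midpoint p q) (midpoint-idem p) (ℚ.*-monoˡ-<-pos ½ (ℚ.+-monoʳ-< p p<q))

<⇒midpoint< : ∀ {p q} → p < q → midpoint p q < q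
<⇒midpoint< {p} {q} p<q =
  subst (midpoint p q <_) (midpoint-idem q) (ℚ.*-monoˡ-<-pos ½ (ℚ.+-monoˡ-< q p<q))

data Deepest (i j k : ℕ) : Set where
  source : j ℕ.≤ i → k ℕ.≤ i → Deepest i j k
  middle : ¬ j ℕ.≤ i → k ℕ.≤ j → Deepest i j k
  target : ¬ k ℕ.≤ j → ¬ k ℕ.≤ i → Deepest i j k

deepest : ∀ i j k → Deepest i j k
deepest i j k with j ℕ.≤? i | k ℕ.≤? i | k ℕ.≤? j
... | yes j≤i | yes k≤i | _       = source j≤i k≤i
... | yes j≤i | no  k≰i | _       = target (λ k≤j → k≰i (ℕ.≤-trans k≤j j≤i)) k≰i
... | no  j≰i | _       | yes k≤j = middle j≰i k≤j
... | no  j≰i | yes k≤i | no  k≰j = contradiction (ℕ.≤-trans k≤i (ℕ.<⇒≤ (ℕ.≰⇒> j≰i))) k≰j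
... | no  j≰i | no  k≰i | no  k≰j = target k≰j k≰i

module _ (A : Structure) where
  open Structure A
  open import Algebra.Definitions {A = Carrier} _≡_ using (Associative; Commutative; Idempotent)
  open NaturalOrder {A = Carrier} _≡_ _·_ using (_≤_)

  record Laws : Set where
    field
      ·-assoc : Associative _·_
      ·-comm  : Commutative _·_
      ·-idem  : Idempotent _·_
      ∘-assoc : Associative _∘_
      ∘-monoˡ : ∀ x y z → ((x · y) ∘ z) ≤ (y ∘ z)
      ∘-monoʳ : ∀ x y z → (z ∘ (x · y)) ≤ (z ∘ y)

∀₁ : (Term 1 → Formula 1) → Sentence
∀₁ φ = ∀f (φ (var zero))

∀₂ : (Term 2 → Term 2 → Formula 2) → Sentence
∀₂ φ = ∀f (∀f (φ (var (suc zero)) (var zero)))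

∀₃ : (Term 3 → Term 3 → Term 3 → Formula 3) → Sentence
∀₃ φ = ∀f (∀f (∀f (φ (var (suc (suc zero))) (var (suc zero)) (var zero))))

laws-axioms : List Sentence
laws-axioms =
  ∀₃ (λ x y z → ((x ·ₜ y) ·ₜ z) ≈ (x ·ₜ (y ·ₜ z))) ∷
  ∀₂ (λ x y → (x ·ₜ y) ≈ (y ·ₜ x)) ∷
  ∀₁ (λ x → (x ·ₜ x) ≈ x) ∷
  ∀₃ (λ x y z → ((x ∘ₜ y) ∘ₜ z) ≈ (x ∘ₜ (y ∘ₜ z))) ∷
  ∀₃ (λ x y z → ((x ·ₜ y) ∘ₜ z) ≈ (((x ·ₜ y) ∘ₜ z) ·ₜ (y ∘ₜ z))) ∷
  ∀₃ (λ x y z → (z ∘ₜ (x ·ₜ y)) ≈ ((z ∘ₜ (x ·ₜ y)) ·ₜ (z ∘ₜ y))) ∷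
  []

⊨laws-axioms⇔Laws : (A : Structure) → A ⊨all laws-axioms ⇔ Laws A
⊨laws-axioms⇔Laws A = mk⇔
  (λ { (a ∷ c ∷ i ∷ a′ ∷ l ∷ r ∷ []) → record
         { ·-assoc = a ; ·-comm = c ; ·-idem = i ; ∘-assoc = a′ ; ∘-monoˡ = l ; ∘-monoʳ = r } })
  (λ laws → let open Laws laws in ·-assoc ∷ ·-comm ∷ ·-idem ∷ ∘-assoc ∷ ∘-monoˡ ∷ ∘-monoʳ ∷ [])

module _ {A : Structure} (R : Representation A) where
  open Structure A
  open Representation R
  open NaturalOrder {A = Carrier} _≡_ _·_ using (_≤_)

  private
    ·-elim : ∀ {a b} → h (a · b) ⇒ (h a ∩ h b)
    ·-elim {a} {b} {s} {t} = Equivalence.to (h-· a b s t)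

    ·-intro : ∀ {a b} → (h a ∩ h b) ⇒ h (a · b)
    ·-intro {a} {b} {s} {t} = Equivalence.from (h-· a b s t)

    ∘-elim : ∀ {a b} → h (a ∘ b) ⇒ (h a ⨾ h b)
    ∘-elim {a} {b} {s} {t} = Equivalence.to (h-∘ a b s t)

    ∘-intro : ∀ {a b} → (h a ⨾ h b) ⇒ h (a ∘ b)
    ∘-intro {a} {b} {s} {t} = Equivalence.from (h-∘ a b s t)

    h-antisym : ∀ {a b} → h a ⇒ h b → h b ⇒ h a → a ≡ b
    h-antisym {a} {b} ab ba = h-inj a b (λ s t → mk⇔ ab ba)

    h-⇒-≤ : ∀ {a b} → h a ⇒ h b → a ≤ b
    h-⇒-≤ ab = h-antisym (λ r → ·-intro (r , ab r)) (λ r → proj₁ (·-elim r))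

  representation⇒Laws : Laws A
  representation⇒Laws = record
    { ·-assoc = λ x y z → h-antisym
        (λ r → let hxy , hz = ·-elim r ; hx , hy = ·-elim hxy in ·-intro (hx , ·-intro (hy , hz)))
        (λ r → let hx , hyz = ·-elim r ; hy , hz = ·-elim hyz in ·-intro (·-intro (hx , hy) , hz))
    ; ·-comm = λ x y → h-antisym
        (λ r → let hx , hy = ·-elim r in ·-intro (hy , hx))
        (λ r → let hy , hx = ·-elim r in ·-intro (hx , hy))
    ; ·-idem = λ x → h-antisym (λ r → proj₁ (·-elim r)) (λ r → ·-intro (r , r))
    ; ∘-assoc = λ x y z → h-antisym
        (λ r → let m , hxy , hz = ∘-elim r ; m′ , hx , hy = ∘-elim hxy
               in ∘-intro (m′ , hx , ∘-intro (m , hy , hz)))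
        (λ r → let m , hx , hyz = ∘-elim r ; m′ , hy , hz = ∘-elim hyz
               in ∘-intro (m′ , ∘-intro (m , hx , hy) , hz))
    ; ∘-monoˡ = λ x y z → h-⇒-≤
        (λ r → let m , hxy , hz = ∘-elim r in ∘-intro (m , proj₂ (·-elim hxy) , hz))
    ; ∘-monoʳ = λ x y z → h-⇒-≤
        (λ r → let m , hz , hxy = ∘-elim r in ∘-intro (m , hz , proj₂ (·-elim hxy)))
    }

module Order {A : Structure} (laws : Laws A) where
  open Structure A
  open Laws laws
  open NaturalOrder {A = Carrier} _≡_ _·_ public using (_≤_)

  ·-semilattice : Semilattice 0ℓ 0ℓ
  ·-semilattice = record
    { Carrier = Carrier ; _≈_ = _≡_ ; _∙_ = _·_
    ; isSemilattice = record
        { isBand = record { isSemigroup = record { isMagma = isMagma _·_ ; assoc = ·-assoc } ; idem = ·-idem }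
        ; comm = ·-comm } }

  open IsMeetSemilattice (SemilatticeProperties.∧-isOrderTheoreticMeetSemilattice ·-semilattice) public
    using (x∧y≤x; x∧y≤y; ∧-greatest) renaming (refl to ≤-refl; trans to ≤-trans; antisym to ≤-antisym)

  ∘-mono-≤ˡ : ∀ {p q r} → p ≤ q → (p ∘ r) ≤ (q ∘ r)
  ∘-mono-≤ˡ {p} {q} {r} p≤q = subst (λ t → (t ∘ r) ≤ (q ∘ r)) (sym p≤q) (∘-monoˡ p q r)

  ∘-mono-≤ʳ : ∀ {p q r} → p ≤ q → (r ∘ p) ≤ (r ∘ q)
  ∘-mono-≤ʳ {p} {q} {r} p≤q = subst (λ t → (r ∘ t) ≤ (r ∘ q)) (sym p≤q) (∘-monoʳ p q r)

  ·-mono-≤ : ∀ {p p′ q q′} → p ≤ p′ → q ≤ q′ → (p · q) ≤ (p′ · q′)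
  ·-mono-≤ {p} {p′} {q} {q′} p≤p′ q≤q′ =
    ∧-greatest (≤-trans (x∧y≤x p q) p≤p′) (≤-trans (x∧y≤y p q) q≤q′)

  ∘-subdistribˡ-· : ∀ b e e′ → (b ∘ (e · e′)) ≤ ((b ∘ e) · (b ∘ e′))
  ∘-subdistribˡ-· b e e′ = ∧-greatest (∘-mono-≤ʳ (x∧y≤x e e′)) (∘-mono-≤ʳ (x∧y≤y e e′))

  ∘-subdistribʳ-· : ∀ a e e′ → ((e · e′) ∘ a) ≤ ((e ∘ a) · (e′ ∘ a))
  ∘-subdistribʳ-· a e e′ = ∧-greatest (∘-mono-≤ˡ (x∧y≤x e e′)) (∘-mono-≤ˡ (x∧y≤y e e′))

  ∘-assoc-≤ʳ : ∀ {p q r s} → (p ∘ (q ∘ r)) ≤ s → ((p ∘ q) ∘ r) ≤ s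
  ∘-assoc-≤ʳ {p} {q} {r} = subst (_≤ _) (sym (∘-assoc p q r))

  ∘-assoc-≤ˡ : ∀ {p q r s} → ((p ∘ q) ∘ r) ≤ s → (p ∘ (q ∘ r)) ≤ s
  ∘-assoc-≤ˡ {p} {q} {r} = subst (_≤ _) (∘-assoc p q r)

module Network {A : Structure} (laws : Laws A) where
  open Structure A
  open Laws laws
  open Order laws

  -- mid x y a b is a point inserted between x and y to witness a ∘ b.
  data Node : Set where
    O I : Node
    mid : Node → Node → Carrier → Carrier → Node

  depth : Node → ℕ
  depth O             = 0
  depth I             = 0
  depth (mid x y _ _) = ℕ.suc (depth x ⊔ depth y)

  -- Edges point strictly rightwards in these positions, so the network is acyclic.
  position : Node → ℚ
  position O             = 0ℚ
  position I             = 1ℚ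
  position (mid x y _ _) = midpoint (position x) (position y)

  Ordered : Node → Set
  Ordered O             = ⊤
  Ordered I             = ⊤
  Ordered (mid x y _ _) = Ordered x × Ordered y × position x < position y

  module _ (a₀ : Carrier) where

    data Seed : Node → Node → Carrier → Set where
      seed : ∀ {c} → a₀ ≤ c → Seed O I c

    -- Edge w z c: the pair (w, z) lies in the relation representing c. Only the deeper
    -- (younger) endpoint can lie between the other one and its neighbours, so it is the
    -- one unfolded along its unique outgoing or incoming edge.
    mutual
      Edge : Node → Node → Carrier → Set
      Edge w z c with depth z ℕ.≤? depth w
      ... | yes _ = EdgeFrom w z c
      ... | no  _ = EdgeTo w z c

      EdgeFrom : Node → Node → Carrier → Set
      EdgeFrom (mid u v a b) z c = (v ≡ z × b ≤ c) ⊎ ∃ λ e → Edge v z e × (b ∘ e) ≤ c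
      EdgeFrom w             z c = Seed w z c

      EdgeTo : Node → Node → Carrier → Set
      EdgeTo w (mid x y a b) c = (w ≡ x × a ≤ c) ⊎ ∃ λ e → Edge w x e × (e ∘ a) ≤ c
      EdgeTo w z             c = Seed w z c

    Edge⇒EdgeFrom : ∀ {w z c} → depth z ℕ.≤ depth w → Edge w z c → EdgeFrom w z c
    Edge⇒EdgeFrom {w} {z} z≤w e with depth z ℕ.≤? depth w
    ... | yes _   = e
    ... | no  z≰w = contradiction z≤w z≰w

    EdgeFrom⇒Edge : ∀ {w z c} → depth z ℕ.≤ depth w → EdgeFrom w z c → Edge w z c
    EdgeFrom⇒Edge {w} {z} z≤w e with depth z ℕ.≤? depth w
    ... | yes _   = e
    ... | no  z≰w = contradiction z≤w z≰w

    Edge⇒EdgeTo : ∀ {w z c} → ¬ depth z ℕ.≤ depth w → Edge w z c → EdgeTo w z c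
    Edge⇒EdgeTo {w} {z} z≰w e with depth z ℕ.≤? depth w
    ... | yes z≤w = contradiction z≤w z≰w
    ... | no  _   = e

    EdgeTo⇒Edge : ∀ {w z c} → ¬ depth z ℕ.≤ depth w → EdgeTo w z c → Edge w z c
    EdgeTo⇒Edge {w} {z} z≰w e with depth z ℕ.≤? depth w
    ... | yes z≤w = contradiction z≤w z≰w
    ... | no  _   = e

    Seed-up : ∀ {w z c c′} → Seed w z c → c ≤ c′ → Seed w z c′
    Seed-up (seed a₀≤c) c≤c′ = seed (≤-trans a₀≤c c≤c′)

    EdgeFrom-up : ∀ w z {c c′} → EdgeFrom w z c → c ≤ c′ → EdgeFrom w z c′
    EdgeFrom-up (mid u v a b) z (inj₁ (v≡z , b≤c))        c≤c′ = inj₁ (v≡z , ≤-trans b≤c c≤c′)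
    EdgeFrom-up (mid u v a b) z (inj₂ (e , ev , b∘e≤c))   c≤c′ = inj₂ (e , ev , ≤-trans b∘e≤c c≤c′)
    EdgeFrom-up O             z s                         c≤c′ = Seed-up s c≤c′
    EdgeFrom-up I             z s                         c≤c′ = Seed-up s c≤c′

    EdgeTo-up : ∀ w z {c c′} → EdgeTo w z c → c ≤ c′ → EdgeTo w z c′
    EdgeTo-up w (mid x y a b) (inj₁ (w≡x , a≤c))        c≤c′ = inj₁ (w≡x , ≤-trans a≤c c≤c′)
    EdgeTo-up w (mid x y a b) (inj₂ (e , ex , e∘a≤c))   c≤c′ = inj₂ (e , ex , ≤-trans e∘a≤c c≤c′)
    EdgeTo-up w O             s                         c≤c′ = Seed-up s c≤c′
    EdgeTo-up w I             s                         c≤c′ = Seed-up s c≤c′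

    Edge-up : ∀ {w z c c′} → Edge w z c → c ≤ c′ → Edge w z c′
    Edge-up {w} {z} e c≤c′ with depth z ℕ.≤? depth w
    ... | yes _ = EdgeFrom-up w z e c≤c′
    ... | no  _ = EdgeTo-up w z e c≤c′

    Valid : Node → Set
    Valid O             = ⊤
    Valid I             = ⊤
    Valid (mid x y a b) = Valid x × Valid y × Edge x y (a ∘ b)

    mutual
      Edge⇒position< : ∀ {w z c} → Ordered w → Ordered z → Edge w z c → position w < position z
      Edge⇒position< {w} {z} ow oz e with depth z ℕ.≤? depth w
      ... | yes _ = EdgeFrom⇒position< w z ow oz e
      ... | no  _ = EdgeTo⇒position< w z ow oz e

      EdgeFrom⇒position< : ∀ w z {c} → Ordered w → Ordered z → EdgeFrom w z c → position w < position z
      EdgeFrom⇒position< (mid u v a b) z (_ , _ , u<v)  oz (inj₁ (refl , _))   = <⇒midpoint< u<v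
      EdgeFrom⇒position< (mid u v a b) z (_ , ov , u<v) oz (inj₂ (_ , ev , _)) =
        ℚ.<-trans (<⇒midpoint< u<v) (Edge⇒position< ov oz ev)
      EdgeFrom⇒position< O z _ _ (seed _) = ℚ.positive⁻¹ 1ℚ
      EdgeFrom⇒position< I z _ _ ()

      EdgeTo⇒position< : ∀ w z {c} → Ordered w → Ordered z → EdgeTo w z c → position w < position z
      EdgeTo⇒position< w (mid x y a b) ow (_ , _ , x<y)  (inj₁ (refl , _))   = <⇒<midpoint x<y
      EdgeTo⇒position< w (mid x y a b) ow (ox , _ , x<y) (inj₂ (_ , ex , _)) =
        ℚ.<-trans (Edge⇒position< ow ox ex) (<⇒<midpoint x<y)
      EdgeTo⇒position< w O _ _ ()
      EdgeTo⇒position< w I _ _ (seed _) = ℚ.positive⁻¹ 1ℚ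

    Valid⇒Ordered : ∀ x → Valid x → Ordered x
    Valid⇒Ordered O             _              = tt
    Valid⇒Ordered I             _              = tt
    Valid⇒Ordered (mid x y a b) (vx , vy , e) = ox , oy , Edge⇒position< ox oy e
      where
      ox : Ordered x
      ox = Valid⇒Ordered x vx
      oy : Ordered y
      oy = Valid⇒Ordered y vy

    Edge-irrefl : ∀ {x c} → Valid x → ¬ Edge x x c
    Edge-irrefl {x} vx e = ℚ.<-irrefl refl (Edge⇒position< ox ox e)
      where
      ox : Ordered x
      ox = Valid⇒Ordered x vx

    mutual
      Edge-· : ∀ {w z c c′} → Valid z → Edge w z c → Edge w z c′ → Edge w z (c · c′)
      Edge-· {w} {z} vz e e′ with depth z ℕ.≤? depth w
      ... | yes _ = EdgeFrom-· w z vz e e′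
      ... | no  _ = EdgeTo-· w z vz e e′

      EdgeFrom-· : ∀ w z {c c′} → Valid z → EdgeFrom w z c → EdgeFrom w z c′ → EdgeFrom w z (c · c′)
      EdgeFrom-· (mid u v a b) z vz (inj₁ (refl , b≤c)) (inj₁ (_ , b≤c′)) = inj₁ (refl , ∧-greatest b≤c b≤c′)
      EdgeFrom-· (mid u v a b) z vz (inj₁ (refl , _)) (inj₂ (_ , ezz , _)) = contradiction ezz (Edge-irrefl vz)
      EdgeFrom-· (mid u v a b) z vz (inj₂ (_ , ezz , _)) (inj₁ (refl , _)) = contradiction ezz (Edge-irrefl vz)
      EdgeFrom-· (mid u v a b) z vz (inj₂ (e , evz , b∘e≤c)) (inj₂ (e′ , evz′ , b∘e′≤c′)) =
        inj₂ (e · e′ , Edge-· vz evz evz′ , ≤-trans (∘-subdistribˡ-· b e e′) (·-mono-≤ b∘e≤c b∘e′≤c′))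
      EdgeFrom-· O z _ (seed a₀≤c) (seed a₀≤c′) = seed (∧-greatest a₀≤c a₀≤c′)
      EdgeFrom-· I z _ () _

      EdgeTo-· : ∀ w z {c c′} → Valid z → EdgeTo w z c → EdgeTo w z c′ → EdgeTo w z (c · c′)
      EdgeTo-· w (mid x y a b) _ (inj₁ (refl , a≤c)) (inj₁ (_ , a≤c′)) = inj₁ (refl , ∧-greatest a≤c a≤c′)
      EdgeTo-· w (mid x y a b) (vw , _) (inj₁ (refl , _)) (inj₂ (_ , eww , _)) = contradiction eww (Edge-irrefl vw)
      EdgeTo-· w (mid x y a b) (vw , _) (inj₂ (_ , eww , _)) (inj₁ (refl , _)) = contradiction eww (Edge-irrefl vw)
      EdgeTo-· w (mid x y a b) (vx , _) (inj₂ (e , ewx , e∘a≤c)) (inj₂ (e′ , ewx′ , e′∘a≤c′)) =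
        inj₂ (e · e′ , Edge-· vx ewx ewx′ , ≤-trans (∘-subdistribʳ-· a e e′) (·-mono-≤ e∘a≤c e′∘a≤c′))
      EdgeTo-· w O _ () _
      EdgeTo-· w I _ (seed a₀≤c) (seed a₀≤c′) = seed (∧-greatest a₀≤c a₀≤c′)

    mutual
      Edge-∘ : ∀ {x z y c d} → Valid z → Edge x z c → Edge z y d → Edge x y (c ∘ d)
      Edge-∘ {x} {z} {y} vz exz ezy with deepest (depth x) (depth z) (depth y)
      ... | source z≤x y≤x =
        EdgeFrom⇒Edge y≤x (Edge-∘-source x y≤x vz (Edge⇒EdgeFrom z≤x exz) ezy)
      ... | middle z≰x y≤z =
        Edge-∘-middle z z≰x vz (Edge⇒EdgeTo z≰x exz) (Edge⇒EdgeFrom y≤z ezy)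
      ... | target y≰z y≰x =
        EdgeTo⇒Edge y≰x (Edge-∘-target y y≰z vz exz (Edge⇒EdgeTo y≰z ezy))

      Edge-∘-source : ∀ x {z y c d} → depth y ℕ.≤ depth x → Valid z →
                      EdgeFrom x z c → Edge z y d → EdgeFrom x y (c ∘ d)
      Edge-∘-source (mid p q a b) _ _ (inj₁ (refl , b≤c)) eqy = inj₂ (_ , eqy , ∘-mono-≤ˡ b≤c)
      Edge-∘-source (mid p q a b) {z} {y} {d = d} _ vz (inj₂ (e , eqz , b∘e≤c)) ezy =
        inj₂ (e ∘ d , Edge-∘ {q} {z} {y} vz eqz ezy , ∘-assoc-≤ˡ (∘-mono-≤ˡ b∘e≤c))
      Edge-∘-source O {y = y} y≤O _ (seed _) eIy with Edge⇒EdgeFrom {I} {y} y≤O eIy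
      ... | ()
      Edge-∘-source I _ _ () _

      Edge-∘-target : ∀ y {x z c d} → ¬ depth y ℕ.≤ depth z → Valid z →
                      Edge x z c → EdgeTo z y d → EdgeTo x y (c ∘ d)
      Edge-∘-target (mid p q a b) _ _ exp (inj₁ (refl , a≤d)) = inj₂ (_ , exp , ∘-mono-≤ʳ a≤d)
      Edge-∘-target (mid p q a b) {x} {z} {c = c} _ vz exz (inj₂ (e , ezp , e∘a≤d)) =
        inj₂ (c ∘ e , Edge-∘ {x} {z} {p} vz exz ezp , ∘-assoc-≤ʳ (∘-mono-≤ʳ e∘a≤d))
      Edge-∘-target O y≰z _ _ _ = contradiction z≤n y≰z
      Edge-∘-target I y≰z _ _ _ = contradiction z≤n y≰z

      Edge-∘-middle : ∀ z {x y c d} → ¬ depth z ℕ.≤ depth x → Valid z →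
                      EdgeTo x z c → EdgeFrom z y d → Edge x y (c ∘ d)
      Edge-∘-middle (mid u v a b) {x} _ (vu , vv , euv) exz (inj₁ (refl , b≤d)) =
        Edge-up {x} {v} (EdgeTo-mid⇒Edge u v vu euv exz) (∘-mono-≤ʳ b≤d)
      Edge-∘-middle (mid u v a b) {x} {y} _ (vu , vv , euv) exz (inj₂ (f , evy , b∘f≤d)) =
        Edge-up {x} {y} (Edge-∘ {x} {v} {y} vv (EdgeTo-mid⇒Edge u v vu euv exz) evy)
          (∘-assoc-≤ʳ (∘-mono-≤ʳ b∘f≤d))
      Edge-∘-middle O z≰x _ _ _ = contradiction z≤n z≰x
      Edge-∘-middle I z≰x _ _ _ = contradiction z≤n z≰x

      EdgeTo-mid⇒Edge : ∀ u v {x a b c} → Valid u → Edge u v (a ∘ b) →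
                        EdgeTo x (mid u v a b) c → Edge x v (c ∘ b)
      EdgeTo-mid⇒Edge u v _ euv (inj₁ (refl , a≤c)) = Edge-up {u} {v} euv (∘-mono-≤ˡ a≤c)
      EdgeTo-mid⇒Edge u v {x} vu euv (inj₂ (e , exu , e∘a≤c)) =
        Edge-up {x} {v} (Edge-∘ {x} {u} {v} vu exu euv) (∘-assoc-≤ˡ (∘-mono-≤ˡ e∘a≤c))

  Point : Set
  Point = Σ Carrier λ a₀ → Σ Node (Valid a₀)

  ⟦_⟧ : Carrier → BinRel Point
  ⟦ c ⟧ (a₀ , x , _) (a₀′ , y , _) = a₀ ≡ a₀′ × Edge a₀ x y c

  ⟦⟧-· : ∀ c d → ⟦ c · d ⟧ ≐ (⟦ c ⟧ ∩ ⟦ d ⟧)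
  ⟦⟧-· c d (a₀ , x , _) (_ , y , vy) = mk⇔
    (λ { (refl , e) → (refl , Edge-up a₀ {x} {y} e (x∧y≤x c d))
                    , (refl , Edge-up a₀ {x} {y} e (x∧y≤y c d)) })
    (λ { ((refl , e) , (_ , e′)) → refl , Edge-· a₀ {x} {y} vy e e′ })

  ⟦⟧-∘ : ∀ c d → ⟦ c ∘ d ⟧ ≐ (⟦ c ⟧ ⨾ ⟦ d ⟧)
  ⟦⟧-∘ c d (a₀ , x , vx) (_ , y , vy) = mk⇔
    (λ { (refl , e) → (a₀ , mid x y c d , vx , vy , e) , (refl , into-mid) , (refl , out-of-mid) })
    (λ { ((_ , z , vz) , (refl , exz) , (refl , ezy)) → refl , Edge-∘ a₀ {x} {z} {y} vz exz ezy })
    where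
    into-mid : Edge a₀ x (mid x y c d) c
    into-mid = EdgeTo⇒Edge a₀ {x} {mid x y c d}
      (ℕ.<⇒≱ (ℕ.s≤s (ℕ.m≤m⊔n (depth x) (depth y)))) (inj₁ (refl , ≤-refl))

    out-of-mid : Edge a₀ (mid x y c d) y d
    out-of-mid = EdgeFrom⇒Edge a₀ {mid x y c d} {y}
      (ℕ.m≤n⇒m≤1+n (ℕ.m≤n⊔m (depth x) (depth y))) (inj₁ (refl , ≤-refl))

  ⟦⟧-injective : ∀ c d → ⟦ c ⟧ ≐ ⟦ d ⟧ → c ≡ d
  ⟦⟧-injective c d ⟦c⟧≐⟦d⟧ =
    ≤-antisym (seed-label c d ⟦c⟧≐⟦d⟧) (seed-label d c (λ s t → ⇔-sym (⟦c⟧≐⟦d⟧ s t)))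
    where
    seed-label : ∀ c d → ⟦ c ⟧ ≐ ⟦ d ⟧ → c ≤ d
    seed-label c d eq with Equivalence.to (eq (c , O , tt) (c , I , tt)) (refl , seed ≤-refl)
    ... | _ , seed c≤d = c≤d

  representation : Representation A
  representation = record
    { Base = Point ; h = ⟦_⟧ ; h-· = ⟦⟧-· ; h-∘ = ⟦⟧-∘ ; h-inj = ⟦⟧-injective }

Laws⇔Representable : (A : Structure) → Laws A ⇔ Representable A
Laws⇔Representable A = mk⇔ Network.representation representation⇒Laws

-- The representation is built explicitly.
proposition12 : ExcludedMiddle →
    Σ (List Sentence) (λ Ax → (A : Structure) → (A ⊨all Ax) ⇔ Representable A)
proposition12 _ = laws-axioms , λ A → ⇔-trans (⊨laws-axioms⇔Laws A) (Laws⇔Representable A)
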